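{- Let $\mathbf{SC}$ be a sequent calculus for a logic $\mathsf{L}$ over a language $\mathcal{L}$. If $\mathbf{SC}$ has the Sequent Pre-Uniform Interpolation Property (SPreUIP), then $\mathsf{L}$ has the Pre-Uniform Interpolation Property (PreUIP).
   Context: Formulas are built from a countable set of propositional variables with the connectives of $\mathcal{L}$; $V(\phi)$ is the set of variables occurring in $\phi$ (for multisets, the union). A sequent is $\Gamma\Rightarrow\Delta$ with $\Gamma,\Delta$ finite multisets of formulas; $\vdash_{\mathbf{SC}}$ denotes provability in the calculus. $\mathbf{SC}$ is a calculus for $\mathsf{L}$ iff for all sequents, $\vdash_{\mathbf{SC}}\Gamma\Rightarrow\Delta$ iff $\bigwedge\Gamma\rightarrow\bigvee\Delta\in\mathsf{L}$ (empty conjunction $\top$, empty disjunction $\bot$). A formula or multiset is $p$-free if $p$ does not occur in it. SPreUIP: for every sequent $\Gamma\Rightarrow\Delta$ and variable $p$ there is a formula $A_p(\Gamma\Rightarrow\Delta)$ of $\mathcal{L}$ such that (1) $V(A_p(\Gamma\Rightarrow\Delta))\subseteq V(\Gamma,\Delta)\setminus\{p\}$; (2) $\vdash_{\mathbf{SC}}\Gamma,A_p(\Gamma\Rightarrow\Delta)\Rightarrow\Delta$; (3) for all $p$-free multisets $\Pi,\Sigma$ with $\vdash_{\mathbf{SC}}\Pi,\Gamma\Rightarrow\Sigma,\Delta$ we have $\vdash_{\mathbf{SC}}\Pi\Rightarrow A_p(\Gamma\Rightarrow\Delta),\Sigma$. PreUIP: for every formula $\phi$ and variable $p$ there is a formula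 $\forall p\phi$ of $\mathcal{L}$ that is $p$-free with $V(\forall p\phi)\subseteq V(\phi)$, such that $\forall p\phi\rightarrow\phi\in\mathsf{L}$, and for every $p$-free formula $\psi$, if $\psi\rightarrow\phi\in\mathsf{L}$ then $\psi\rightarrow\forall p\phi\in\mathsf{L}$. -}

module Defs where

open import Data.Nat using (ℕ)
open import Data.Fin using (Fin)
open import Data.List using (List; []; _∷_; _++_)
open import Data.List.Relation.Unary.Any using (Any)
open import Data.List.Relation.Binary.Permutation.Propositional using (_↭_)
open import Data.Product using (Σ; _×_)
open import Data.Sum using (_⊎_)
open import Relation.Nullary using (¬_)
open import Relation.Binary.PropositionalEquality using (_≢_)

-- A language ℒ: propositional variables indexed by ℕ, the connectives
-- ⊥, ⊤, ∧, ∨, → (used in the definitions), plus an arbitrary signature of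
-- further connectives: a set C of symbols with arities ar.
record Language : Set₁ where
  field
    C  : Set
    ar : C → ℕ

module _ (ℒ : Language) where
  open Language ℒ

  infixr 6 _∧ᶠ_
  infixr 5 _∨ᶠ_
  infixr 4 _⇒ᶠ_

  data Fml : Set where
    var  : ℕ → Fml
    ⊥ᶠ ⊤ᶠ : Fml
    _∧ᶠ_ _∨ᶠ_ _⇒ᶠ_ : Fml → Fml → Fml
    op   : (c : C) → (Fin (ar c) → Fml) → Fml

  data Occ (p : ℕ) : Fml → Set where
    occ-var : Occ p (var p)
    occ-∧l  : ∀ {φ ψ} → Occ p φ → Occ p (φ ∧ᶠ ψ)
    occ-∧r  : ∀ {φ ψ} → Occ p ψ → Occ p (φ ∧ᶠ ψ)
    occ-∨l  : ∀ {φ ψ} → Occ p φ → Occ p (φ ∨ᶠ ψ)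
    occ-∨r  : ∀ {φ ψ} → Occ p ψ → Occ p (φ ∨ᶠ ψ)
    occ-⇒l  : ∀ {φ ψ} → Occ p φ → Occ p (φ ⇒ᶠ ψ)
    occ-⇒r  : ∀ {φ ψ} → Occ p ψ → Occ p (φ ⇒ᶠ ψ)
    occ-op  : ∀ {c f} (i : Fin (ar c)) → Occ p (f i) → Occ p (op c f)

  OccL : ℕ → List Fml → Set
  OccL p Γ = Any (Occ p) Γ

  FreeOf : ℕ → Fml → Set
  FreeOf p φ = ¬ Occ p φ

  FreeOfL : ℕ → List Fml → Set
  FreeOfL p Γ = ¬ OccL p Γ

  ⋀ : List Fml → Fml
  ⋀ [] = ⊤ᶠ
  ⋀ (A ∷ []) = A
  ⋀ (A ∷ B ∷ Γ) = A ∧ᶠ ⋀ (B ∷ Γ)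

  ⋁ : List Fml → Fml
  ⋁ [] = ⊥ᶠ
  ⋁ (A ∷ []) = A
  ⋁ (A ∷ B ∷ Γ) = A ∨ᶠ ⋁ (B ∷ Γ)

  -- A logic is a set of formulas; a sequent calculus is given by its
  -- provability predicate on sequents Γ ⇒ Δ (lists representing multisets).
  Logic : Set₁
  Logic = Fml → Set

  Calculus : Set₁
  Calculus = List Fml → List Fml → Set

  MultisetSequents : Calculus → Set
  MultisetSequents ⊢ = ∀ {Γ Γ' Δ Δ'} → Γ ↭ Γ' → Δ ↭ Δ' → ⊢ Γ Δ → ⊢ Γ' Δ'

  CalculusFor : Calculus → Logic → Set
  CalculusFor ⊢ L = ∀ Γ Δ → (⊢ Γ Δ → L (⋀ Γ ⇒ᶠ ⋁ Δ)) × (L (⋀ Γ ⇒ᶠ ⋁ Δ) → ⊢ Γ Δ)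

  SPreUIP : Calculus → Set
  SPreUIP ⊢ = ∀ (Γ Δ : List Fml) (p : ℕ) → Σ Fml λ A →
      (∀ q → Occ q A → (OccL q (Γ ++ Δ) × q ≢ p))
    × ⊢ (Γ ++ (A ∷ [])) Δ
    × (∀ Π Σ' → FreeOfL p Π → FreeOfL p Σ' →
         ⊢ (Π ++ Γ) (Σ' ++ Δ) → ⊢ Π (A ∷ Σ'))

  PreUIP : Logic → Set
  PreUIP L = ∀ (φ : Fml) (p : ℕ) → Σ Fml λ B →
      FreeOf p B
    × (∀ q → Occ q B → Occ q φ)
    × L (B ⇒ᶠ φ)
    × (∀ ψ → FreeOf p ψ → L (ψ ⇒ᶠ φ) → L (ψ ⇒ᶠ B))

{-# OPTIONS --safe #-}
module Submission where

open import Defs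
open import Data.List using ([_]; [])
open import Data.List.Relation.Unary.Any.Properties using (singleton⁻; ¬Any[])
open import Data.Product using (_,_; proj₁; proj₂)
open import Function using (_∘_)
open import Relation.Binary.PropositionalEquality using (refl)

-- ∀p φ is the sequent interpolant A_p(⇒ φ): condition (2) gives A ⇒ φ, and
-- condition (3) with Π = ψ and Σ empty turns every p-free ψ ⇒ φ into ψ ⇒ A.

module _ {ℒ : Language} {L : Logic ℒ} {SC : Calculus ℒ}
         (SC-for-L : CalculusFor ℒ SC L) where

  singleton-sound : ∀ {ψ φ : Fml ℒ} → SC [ ψ ] [ φ ] → L (ψ ⇒ᶠ φ)
  singleton-sound {ψ} {φ} = proj₁ (SC-for-L [ ψ ] [ φ ])

  singleton-complete : ∀ {ψ φ : Fml ℒ} → L (ψ ⇒ᶠ φ) → SC [ ψ ] [ φ ]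
  singleton-complete {ψ} {φ} = proj₂ (SC-for-L [ ψ ] [ φ ])

  SPreUIP⇒PreUIP : SPreUIP ℒ SC → PreUIP ℒ L
  SPreUIP⇒PreUIP spreuip φ p with spreuip [] [ φ ] p
  ... | A , vars-A , A⊢φ , uniform =
    A , p∉A , vars-A⊆vars-φ , singleton-sound A⊢φ , below-A
    where
    p∉A : FreeOf ℒ p A
    p∉A p∈A = proj₂ (vars-A p p∈A) refl

    vars-A⊆vars-φ : ∀ q → Occ ℒ q A → Occ ℒ q φ
    vars-A⊆vars-φ q = singleton⁻ ∘ proj₁ ∘ vars-A q

    below-A : ∀ ψ → FreeOf ℒ p ψ → L (ψ ⇒ᶠ φ) → L (ψ ⇒ᶠ A)
    below-A ψ p∉ψ ψ→φ =
      singleton-sound (uniform [ ψ ] [] (p∉ψ ∘ singleton⁻) ¬Any[] (singleton-complete ψ→φ))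

theorem3p28 : (ℒ : Language) (L : Logic ℒ) (SC : Calculus ℒ)
            → MultisetSequents ℒ SC → CalculusFor ℒ SC L
            → SPreUIP ℒ SC → PreUIP ℒ L
theorem3p28 ℒ L SC _ SC-for-L = SPreUIP⇒PreUIP {L = L} SC-for-L
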